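{- Let $M$ be a connected module of a graph $G$. For any minimum interval supergraph $\widehat G_M$ of $G[M]$, there exists a minimum interval supergraph $\widehat G$ of $G$ such that $E(\widehat G_M)\subseteq E(\widehat G[M])$.
   Context: Graphs are finite, simple, undirected. A set $M$ is a module of $G$ if every vertex outside $M$ is adjacent to all or none of $M$; a connected module if moreover $G[M]$ is connected. An interval supergraph of $G$ is an interval graph on $V(G)$ containing all edges of $G$; it is minimum if it has the minimum number of edges among all interval supergraphs of $G$. -}

module Defs where

open import Data.Nat using (ℕ; zero; suc; _+_; _≤_; _<ᵇ_)
open import Data.Fin using (Fin; toℕ)
open import Data.Bool using (Bool; true; false; _∧_; if_then_else_)
open import Data.List using (List; map; allFin)
open import Data.Nat.ListAction using (sum)
open import Data.Product using (Σ; _×_; ∃; _,_)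
open import Data.Sum using (_⊎_)
open import Relation.Nullary using (¬_)
open import Relation.Binary.PropositionalEquality using (_≡_; _≢_; refl)
open import Function.Bundles using (_⇔_)

record Graph (n : ℕ) : Set where
  field
    adj     : Fin n → Fin n → Bool
    symm    : ∀ i j → adj i j ≡ adj j i
    irrefl  : ∀ i → adj i i ≡ false
open Graph public

VSet : ℕ → Set
VSet n = Fin n → Bool

_∈ᵥ_ : ∀ {n} → Fin n → VSet n → Set
i ∈ᵥ S = S i ≡ true

_∉ᵥ_ : ∀ {n} → Fin n → VSet n → Set
i ∉ᵥ S = S i ≡ false

Full : ∀ {n} → VSet n
Full _ = true

Edge : ∀ {n} → Graph n → Fin n → Fin n → Set
Edge G i j = adj G i j ≡ true

edgeCount : ∀ {n} → Graph n → ℕ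
edgeCount {n} G =
  sum (map (λ i → sum (map (λ j →
        if (toℕ i <ᵇ toℕ j) ∧ adj G i j then 1 else 0) (allFin n))) (allFin n))

-- Induced subgraph G[S], kept on the ambient vertex type Fin n
-- (vertices outside S are simply isolated and ignored).
induced : ∀ {n} → Graph n → VSet n → Graph n
induced {n} G S = record
  { adj = λ i j → S i ∧ S j ∧ adj G i j
  ; symm = sy
  ; irrefl = ir
  }
  where
  sy : ∀ i j → (S i ∧ S j ∧ adj G i j) ≡ (S j ∧ S i ∧ adj G j i)
  sy i j with S i | S j
  ... | true  | true  = symm G i j
  ... | true  | false = refl
  ... | false | true  = refl
  ... | false | false = refl
  ir : ∀ i → (S i ∧ S i ∧ adj G i i) ≡ false
  ir i with S i
  ... | true = irrefl G i
  ... | false = refl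

OnVertexSet : ∀ {n} → VSet n → Graph n → Set
OnVertexSet S H = ∀ i j → Edge H i j → (i ∈ᵥ S) × (j ∈ᵥ S)

IsIntervalOn : ∀ {n} → VSet n → Graph n → Set
IsIntervalOn {n} S H =
  Σ (Fin n → ℕ) λ l → Σ (Fin n → ℕ) λ r →
    (∀ i → i ∈ᵥ S → l i ≤ r i) ×
    (∀ i j → i ∈ᵥ S → j ∈ᵥ S → i ≢ j →
       (Edge H i j ⇔ (l i ≤ r j × l j ≤ r i)))

-- H is an interval supergraph of the graph K, both on vertex set S
-- (K is assumed to be a graph on S, e.g. K = G[S]).
IsIntervalSupergraph : ∀ {n} → VSet n → Graph n → Graph n → Set
IsIntervalSupergraph S K H =
  OnVertexSet S H × (∀ i j → Edge K i j → Edge H i j) × IsIntervalOn S H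

IsMinIntervalSupergraph : ∀ {n} → VSet n → Graph n → Graph n → Set
IsMinIntervalSupergraph S K H =
  IsIntervalSupergraph S K H ×
  (∀ H' → IsIntervalSupergraph S K H' → edgeCount H ≤ edgeCount H')

IsModule : ∀ {n} → Graph n → VSet n → Set
IsModule G M = ∀ v → v ∉ᵥ M →
  (∀ u → u ∈ᵥ M → Edge G v u) ⊎ (∀ u → u ∈ᵥ M → ¬ Edge G v u)

data Reach {n} (H : Graph n) : Fin n → Fin n → Set where
  here : ∀ {u} → Reach H u u
  step : ∀ {u v w} → Edge H u v → Reach H v w → Reach H u w

IsConnectedInduced : ∀ {n} → Graph n → VSet n → Set
IsConnectedInduced G M =
  (∃ λ u → u ∈ᵥ M) ×
  (∀ u v → u ∈ᵥ M → v ∈ᵥ M → Reach (induced G M) u v)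

IsConnectedModule : ∀ {n} → Graph n → VSet n → Set
IsConnectedModule G M = IsModule G M × IsConnectedInduced G M

-- Let H be a minimum interval supergraph of G with interval model (l, r). The vertices
-- outside M that are adjacent to M are, M being a module, adjacent to all of M, so their
-- intervals meet every interval of M. If two of them are disjoint, every interval of M
-- contains the gap between them: H[M] is complete and H itself will do. Otherwise these
-- intervals and the interval of a vertex c ∈ M with fewest neighbours outside M in H
-- share a point p (Helly). Scale H's model up and shrink a model of G_M into the gap at
-- p. Inside M the edges become those of G_M, which has no more edges than H[M]; a vertex
-- of M now sees exactly the outside vertices whose intervals contain p, all of which
-- are adjacent to c in H; edges outside M are unchanged. The result is an interval
-- supergraph of G with at most as many edges as H, hence minimum.
-- That a minimum exists at all needs a finite search: replacing each endpoint by its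
-- rank among all endpoints keeps the interval graph and bounds the endpoints.
module Submission where

open import Defs
import Data.Nat.Properties as Nat
open import Algebra.Properties.CommutativeMonoid.Sum Nat.+-0-commutativeMonoid
  using (sum; sum-syntax; ∑-distrib-+; ∑-comm; sum-cong-≗)
open import Data.Bool using (Bool; true; false; not; _∧_; if_then_else_)
open import Data.Bool.Properties using (⇔→≡; not-injective) renaming (_≟_ to _≟ᵇ_)
open import Data.Fin using (Fin; zero; suc; toℕ; fromℕ<; finToFun; funToFin)
open import Data.Fin.Properties
  using (toℕ-injective; toℕ-fromℕ<; finToFun-funToFin; all?; any?) renaming (_≟_ to _≟ᶠ_)
open import Data.List using (List; _∷_; map; tabulate; allFin; filter; cartesianProduct)
open import Data.List.Extrema.Nat
  using (argmin; argmin-all; f[argmin]≤f[xs]; argmax; argmax-all; f[⊥]≤f[argmax]; f[xs]≤f[argmax])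
open import Data.List.Membership.Propositional using (_∈_)
open import Data.List.Membership.Propositional.Properties
  using (∈-filter⁺; ∈-filter⁻; ∈-allFin; ∈-cartesianProduct⁺)
open import Data.List.Properties using (map-tabulate)
import Data.List.Relation.Unary.All as All
open import Data.List.Relation.Unary.All.Properties using (all-filter)
open import Data.List.Relation.Unary.Any using (here; there)
open import Data.Nat using (ℕ; zero; suc; _+_; _*_; _^_; _≤_; _<_; _<ᵇ_; z≤n; s≤s; s≤s⁻¹)
open import Data.Nat.ListAction using () renaming (sum to sumᴸ)
open import Data.Nat.Properties
  using (_≤?_; _<?_; ≤-refl; ≤-trans; ≤-reflexive; ≤-antisym; <-cmp; <-asym; <-irrefl; <-≤-trans;
         <⇒≤; <⇒≱; ≰⇒>; ≮⇒≥; m≤m+n; m≤n+m; n<1+n; +-comm; +-identityʳ; +-mono-≤; +-mono-≤-<;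
         +-mono-<-≤; +-monoʳ-≤; +-monoʳ-<; +-cancelˡ-≤; *-monoʳ-≤; *-suc; *-cancelˡ-<)
open import Data.Product using (Σ; _×_; _,_; proj₁; proj₂; swap)
open import Data.Product.Function.NonDependent.Propositional using (_×-⇔_)
open import Data.Sum using (_⊎_; inj₁; inj₂)
open import Function using (_∘_; id)
open import Function.Bundles using (_⇔_; mk⇔; Equivalence)
open import Function.Properties.Equivalence using (⇔-isEquivalence)
open import Relation.Binary using (IsEquivalence; tri<; tri≈; tri>)
open import Relation.Binary.PropositionalEquality
  using (_≡_; _≢_; _≗_; refl; sym; trans; cong; cong₂; subst₂; module ≡-Reasoning)
open import Relation.Nullary using (Dec; yes; no; does; contradiction; ¬?)
open import Relation.Nullary.Decidable using (_×-dec_; _→-dec_; does-⇔; dec-true; dec-false)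
open import Relation.Unary using (Pred; Decidable)

open Equivalence
module ⇔ {ℓ} = IsEquivalence (⇔-isEquivalence {ℓ})

⟦_⟧ : Bool → ℕ
⟦ b ⟧ = if b then 1 else 0

⟦⟧-mono : ∀ {b c} → (b ≡ true → c ≡ true) → ⟦ b ⟧ ≤ ⟦ c ⟧
⟦⟧-mono {false} _   = z≤n
⟦⟧-mono {true}  b⇒c rewrite b⇒c refl = ≤-refl

⟦∧⟧-mono : ∀ a {b c} → (a ≡ true → b ≡ true → c ≡ true) → ⟦ a ∧ b ⟧ ≤ ⟦ a ∧ c ⟧
⟦∧⟧-mono false _   = z≤n
⟦∧⟧-mono true  b⇒c = ⟦⟧-mono (b⇒c refl)

⟦⟧≤1 : ∀ b → ⟦ b ⟧ ≤ 1
⟦⟧≤1 false = z≤n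
⟦⟧≤1 true  = ≤-refl

does⇔ : ∀ {a} {A : Set a} (a? : Dec A) → does a? ≡ true ⇔ A
does⇔ (yes a)  = mk⇔ (λ _ → a) (λ _ → refl)
does⇔ (no ¬a) = mk⇔ (λ ()) (λ a → contradiction a ¬a)

∑-mono-≤ : ∀ {n} {f g : Fin n → ℕ} → (∀ i → f i ≤ g i) → sum f ≤ sum g
∑-mono-≤ {zero}  f≤g = z≤n
∑-mono-≤ {suc n} f≤g = +-mono-≤ (f≤g zero) (∑-mono-≤ (f≤g ∘ suc))

∑-mono-< : ∀ {n} {f g : Fin n → ℕ} → (∀ i → f i ≤ g i) → ∀ k → f k < g k → sum f < sum g
∑-mono-< f≤g zero    fk<gk = +-mono-<-≤ fk<gk (∑-mono-≤ (f≤g ∘ suc))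
∑-mono-< f≤g (suc k) fk<gk = +-mono-≤-< (f≤g zero) (∑-mono-< (f≤g ∘ suc) k fk<gk)

∑-term : ∀ {n} (f : Fin n → ℕ) k → f k ≤ sum f
∑-term f zero    = m≤m+n _ _
∑-term f (suc k) = ≤-trans (∑-term (f ∘ suc) k) (m≤n+m _ _)

sumᴸ-allFin : ∀ {n} (f : Fin n → ℕ) → sumᴸ (map f (allFin n)) ≡ ∑[ i < n ] f i
sumᴸ-allFin f = trans (cong sumᴸ (map-tabulate id f)) (sumᴸ-tabulate f)
  where
  sumᴸ-tabulate : ∀ {n} (f : Fin n → ℕ) → sumᴸ (tabulate f) ≡ sum f
  sumᴸ-tabulate {zero}  f = refl
  sumᴸ-tabulate {suc n} f = cong (f zero +_) (sumᴸ-tabulate (f ∘ suc))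

∑∑ : ∀ {n} → (Fin n → Fin n → ℕ) → ℕ
∑∑ {n} f = ∑[ i < n ] ∑[ j < n ] f i j

∑∑-cong : ∀ {n} {f g : Fin n → Fin n → ℕ} → (∀ i j → f i j ≡ g i j) → ∑∑ f ≡ ∑∑ g
∑∑-cong f≡g = sum-cong-≗ (λ i → sum-cong-≗ (f≡g i))

∑∑-distrib-+ : ∀ {n} (f g : Fin n → Fin n → ℕ) → ∑∑ (λ i j → f i j + g i j) ≡ ∑∑ f + ∑∑ g
∑∑-distrib-+ f g = trans (sum-cong-≗ (λ i → ∑-distrib-+ (f i) (g i)))
  (∑-distrib-+ (λ i → ∑[ j < _ ] f i j) (λ i → ∑[ j < _ ] g i j))

_⊆ᴱ_ : ∀ {n} → Graph n → Graph n → Set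
H ⊆ᴱ K = ∀ i j → Edge H i j → Edge K i j

SameEdges : ∀ {n} → Graph n → Graph n → Set
SameEdges H K = ∀ i j → Edge H i j ⇔ Edge K i j

edge⇒≢ : ∀ {n} (H : Graph n) {i j} → Edge H i j → i ≢ j
edge⇒≢ H {i} e refl with () ← trans (sym e) (irrefl H i)

edge-sym : ∀ {n} (H : Graph n) {i j} → Edge H i j → Edge H j i
edge-sym H {i} {j} e = trans (symm H j i) e

∈ᵥ-or-∉ᵥ : ∀ {n} (S : VSet n) i → i ∈ᵥ S ⊎ i ∉ᵥ S
∈ᵥ-or-∉ᵥ S i with S i
... | true  = inj₁ refl
... | false = inj₂ refl

∈≢∉ : ∀ {n} {S : VSet n} {i j} → i ∈ᵥ S → j ∉ᵥ S → i ≢ j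
∈≢∉ i∈S j∉S refl with () ← trans (sym i∈S) j∉S

induced-edge⇔ : ∀ {n} (H : Graph n) (S : VSet n) {i j} → i ∈ᵥ S → j ∈ᵥ S →
  Edge (induced H S) i j ⇔ Edge H i j
induced-edge⇔ H S i∈S j∈S rewrite i∈S | j∈S = ⇔.refl

induced-edge⁻ : ∀ {n} (H : Graph n) (S : VSet n) {i j} → Edge (induced H S) i j → i ∈ᵥ S × j ∈ᵥ S
induced-edge⁻ H S {i} {j} e with S i | S j
induced-edge⁻ H S () | false | _
induced-edge⁻ H S () | true  | false
... | true | true = refl , refl

induced-onVertexSet : ∀ {n} (H : Graph n) {K : Graph n} (S : VSet n) → OnVertexSet S K →
  (∀ {i j} → i ∈ᵥ S → j ∈ᵥ S → Edge H i j ⇔ Edge K i j) → SameEdges (induced H S) K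
induced-onVertexSet H S K-on-S H≅K i j = mk⇔
  (λ e → let (i∈S , j∈S) = induced-edge⁻ H S e in to (H≅K i∈S j∈S) (to (induced-edge⇔ H S i∈S j∈S) e))
  (λ e → let (i∈S , j∈S) = K-on-S i j e in from (induced-edge⇔ H S i∈S j∈S) (from (H≅K i∈S j∈S) e))

pairCount : ∀ {n} → Graph n → ℕ
pairCount H = ∑∑ λ i j → ⟦ adj H i j ⟧

⟦adj⟧-split : ∀ {n} (H : Graph n) i j →
  ⟦ adj H i j ⟧ ≡ ⟦ (toℕ i <ᵇ toℕ j) ∧ adj H i j ⟧ + ⟦ (toℕ j <ᵇ toℕ i) ∧ adj H i j ⟧
⟦adj⟧-split H i j with <-cmp (toℕ i) (toℕ j)
... | tri< i<j _ _
  rewrite dec-true (toℕ i <? toℕ j) i<j | dec-false (toℕ j <? toℕ i) (<-asym i<j) =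
  sym (+-identityʳ _)
... | tri> _ _ j<i
  rewrite dec-false (toℕ i <? toℕ j) (<-asym j<i) | dec-true (toℕ j <? toℕ i) j<i = refl
... | tri≈ _ i≡j _ with refl ← toℕ-injective i≡j
  rewrite dec-false (toℕ i <? toℕ i) (<-irrefl refl) | irrefl H i = refl

edgeCount≡∑∑ : ∀ {n} (H : Graph n) → edgeCount H ≡ ∑∑ λ i j → ⟦ (toℕ i <ᵇ toℕ j) ∧ adj H i j ⟧
edgeCount≡∑∑ {n} H = trans (sumᴸ-allFin {n} _) (sum-cong-≗ {n} λ i → sumᴸ-allFin {n} _)

edgeCount-double : ∀ {n} (H : Graph n) → edgeCount H + edgeCount H ≡ pairCount H
edgeCount-double {n} H = sym (begin
  pairCount H                        ≡⟨ ∑∑-cong (⟦adj⟧-split H) ⟩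
  ∑∑ (λ i j → below i j + above i j) ≡⟨ ∑∑-distrib-+ below above ⟩
  ∑∑ below + ∑∑ above                ≡⟨ cong (∑∑ below +_) (∑-comm above) ⟩
  ∑∑ below + ∑∑ (λ j i → above i j)  ≡⟨ cong (∑∑ below +_) (∑∑-cong λ j i → cong (λ b → ⟦ _ ∧ b ⟧)
                                                                               (symm H i j)) ⟩
  ∑∑ below + ∑∑ below                ≡⟨ cong₂ _+_ (edgeCount≡∑∑ H) (edgeCount≡∑∑ H) ⟨
  edgeCount H + edgeCount H          ∎)
  where
  open ≡-Reasoning
  below above : Fin n → Fin n → ℕ
  below i j = ⟦ (toℕ i <ᵇ toℕ j) ∧ adj H i j ⟧
  above i j = ⟦ (toℕ j <ᵇ toℕ i) ∧ adj H i j ⟧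

edgeCount-≤⇔ : ∀ {n} (H H′ : Graph n) → edgeCount H ≤ edgeCount H′ ⇔ pairCount H ≤ pairCount H′
edgeCount-≤⇔ H H′ = mk⇔
  (λ e≤e′ → subst₂ _≤_ (edgeCount-double H) (edgeCount-double H′) (+-mono-≤ e≤e′ e≤e′))
  (λ p≤p′ → halve (subst₂ _≤_ (sym (edgeCount-double H)) (sym (edgeCount-double H′)) p≤p′))
  where
  halve : ∀ {a b} → a + a ≤ b + b → a ≤ b
  halve {a} {b} a+a≤b+b with a ≤? b
  ... | yes a≤b = a≤b
  ... | no a≰b  = contradiction a+a≤b+b (<⇒≱ (Nat.+-mono-< (≰⇒> a≰b) (≰⇒> a≰b)))

pairCount-cong : ∀ {n} {H K : Graph n} → SameEdges H K → pairCount H ≡ pairCount K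
pairCount-cong H≅K = ∑∑-cong λ i j → cong ⟦_⟧ (⇔→≡ (H≅K i j))

edgeCount-cong : ∀ {n} (H K : Graph n) → SameEdges H K → edgeCount H ≡ edgeCount K
edgeCount-cong H K H≅K = ≤-antisym
  (from (edgeCount-≤⇔ H K) (≤-reflexive (pairCount-cong {H = H} {K} H≅K)))
  (from (edgeCount-≤⇔ K H) (≤-reflexive (sym (pairCount-cong {H = H} {K} H≅K))))

-- Edges are counted in the blocks S × S, S × ∁S, ∁S × S and ∁S × ∁S of ordered pairs.
module Blocks {n} (S : VSet n) where

  outDegree : Graph n → Fin n → ℕ
  outDegree H i = ∑[ j < n ] ⟦ not (S j) ∧ adj H i j ⟧

  private
    crossCount outerCount : Graph n → ℕ
    crossCount H = ∑∑ {n} λ i j → ⟦ S i ∧ not (S j) ∧ adj H i j ⟧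
    outerCount H = ∑∑ {n} λ i j → ⟦ not (S i) ∧ not (S j) ∧ adj H i j ⟧

    split4 : ∀ x y b →
      ⟦ b ⟧ ≡ ⟦ x ∧ y ∧ b ⟧ + (⟦ x ∧ not y ∧ b ⟧ + ⟦ not x ∧ y ∧ b ⟧) + ⟦ not x ∧ not y ∧ b ⟧
    split4 true  true  b     = sym (trans (+-identityʳ _) (+-identityʳ _))
    split4 true  false true  = refl
    split4 true  false false = refl
    split4 false true  true  = refl
    split4 false true  false = refl
    split4 false false b     = refl

    pairCount-blocks : ∀ H →
      pairCount H ≡ pairCount (induced H S) + (crossCount H + crossCount H) + outerCount H
    pairCount-blocks H = begin
      pairCount H
        ≡⟨ ∑∑-cong (λ i j → split4 (S i) (S j) (adj H i j)) ⟩
      ∑∑ (λ i j → inner i j + (out i j + into i j) + outer i j)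
        ≡⟨ ∑∑-distrib-+ _ outer ⟩
      ∑∑ (λ i j → inner i j + (out i j + into i j)) + outerCount H
        ≡⟨ cong (_+ outerCount H) (∑∑-distrib-+ inner _) ⟩
      pairCount (induced H S) + ∑∑ (λ i j → out i j + into i j) + outerCount H
        ≡⟨ cong (λ c → pairCount (induced H S) + c + outerCount H) (∑∑-distrib-+ out into) ⟩
      pairCount (induced H S) + (crossCount H + ∑∑ into) + outerCount H
        ≡⟨ cong (λ c → pairCount (induced H S) + (crossCount H + c) + outerCount H) into≡out ⟩
      pairCount (induced H S) + (crossCount H + crossCount H) + outerCount H ∎
      where
      open ≡-Reasoning
      inner out into outer : Fin n → Fin n → ℕ
      inner i j = ⟦ S i ∧ S j ∧ adj H i j ⟧
      out   i j = ⟦ S i ∧ not (S j) ∧ adj H i j ⟧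
      into  i j = ⟦ not (S i) ∧ S j ∧ adj H i j ⟧
      outer i j = ⟦ not (S i) ∧ not (S j) ∧ adj H i j ⟧
      transpose : ∀ j i → into i j ≡ out j i
      transpose j i rewrite symm H i j with S i | S j
      ... | true  | true  = refl
      ... | true  | false = refl
      ... | false | true  = refl
      ... | false | false = refl
      into≡out : ∑∑ into ≡ crossCount H
      into≡out = trans (∑-comm into) (∑∑-cong transpose)

  edgeCount-≤-byBlocks : ∀ {H′ H} →
    edgeCount (induced H′ S) ≤ edgeCount (induced H S) →
    (∀ {i} → i ∈ᵥ S → outDegree H′ i ≤ outDegree H i) →
    (∀ {i j} → i ∉ᵥ S → j ∉ᵥ S → Edge H′ i j ⇔ Edge H i j) →
    edgeCount H′ ≤ edgeCount H
  edgeCount-≤-byBlocks {H′} {H} inner≤ out≤ outer≅ = from (edgeCount-≤⇔ H′ H) (begin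
    pairCount H′
      ≡⟨ pairCount-blocks H′ ⟩
    pairCount (induced H′ S) + (crossCount H′ + crossCount H′) + outerCount H′
      ≤⟨ +-mono-≤ (+-mono-≤ (to (edgeCount-≤⇔ (induced H′ S) (induced H S)) inner≤)
                            (+-mono-≤ cross≤ cross≤))
                  (≤-reflexive outer≡) ⟩
    pairCount (induced H S) + (crossCount H + crossCount H) + outerCount H
      ≡⟨ pairCount-blocks H ⟨
    pairCount H ∎)
    where
    open Nat.≤-Reasoning
    row≤ : ∀ i → ∑[ j < n ] ⟦ S i ∧ not (S j) ∧ adj H′ i j ⟧
               ≤ ∑[ j < n ] ⟦ S i ∧ not (S j) ∧ adj H i j ⟧
    row≤ i with S i in i∈S
    ... | true  = out≤ i∈S
    ... | false = ≤-refl
    cross≤ : crossCount H′ ≤ crossCount H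
    cross≤ = ∑-mono-≤ row≤
    outer-pointwise : ∀ i j → ⟦ not (S i) ∧ not (S j) ∧ adj H′ i j ⟧
                            ≡ ⟦ not (S i) ∧ not (S j) ∧ adj H i j ⟧
    outer-pointwise i j with S i in i∉S | S j in j∉S
    ... | false | false = cong ⟦_⟧ (⇔→≡ (outer≅ i∉S j∉S))
    ... | false | true  = refl
    ... | true  | _     = refl
    outer≡ : outerCount H′ ≡ outerCount H
    outer≡ = ∑∑-cong {n} outer-pointwise

Overlap : ∀ {n} (l r : Fin n → ℕ) → Fin n → Fin n → Set
Overlap l r i j = l i ≤ r j × l j ≤ r i

overlap? : ∀ {n} (l r : Fin n → ℕ) i j → Dec (Overlap l r i j)
overlap? l r i j = l i ≤? r j ×-dec l j ≤? r i

overlap-cong : ∀ {n} {l r l′ r′ : Fin n → ℕ} → l ≗ l′ → r ≗ r′ →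
  ∀ i j → Overlap l r i j ⇔ Overlap l′ r′ i j
overlap-cong l≗l′ r≗r′ i j rewrite l≗l′ i | l≗l′ j | r≗r′ i | r≗r′ j = ⇔.refl

intervalGraph : ∀ {n} (l r : Fin n → ℕ) → Graph n
intervalGraph l r = record
  { adj    = λ i j → does (edge? i j)
  ; symm   = λ i j → does-⇔ (mk⇔ flip-edge flip-edge) (edge? i j) (edge? j i)
  ; irrefl = λ i → dec-false (edge? i i) λ (i≢i , _) → i≢i refl
  }
  where
  edge? : ∀ i j → Dec (i ≢ j × Overlap l r i j)
  edge? i j = ¬? (i ≟ᶠ j) ×-dec overlap? l r i j
  flip-edge : ∀ {i j} → i ≢ j × Overlap l r i j → j ≢ i × Overlap l r j i
  flip-edge (i≢j , o) = i≢j ∘ sym , swap o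

intervalGraph-edge : ∀ {n} (l r : Fin n → ℕ) {i j} →
  Edge (intervalGraph l r) i j ⇔ (i ≢ j × Overlap l r i j)
intervalGraph-edge l r {i} {j} = does⇔ (¬? (i ≟ᶠ j) ×-dec overlap? l r i j)

intervalGraph-isIntervalSupergraph : ∀ {n} (G : Graph n) (l r : Fin n → ℕ) →
  (∀ i → l i ≤ r i) → G ⊆ᴱ intervalGraph l r → IsIntervalSupergraph Full G (intervalGraph l r)
intervalGraph-isIntervalSupergraph G l r l≤r G⊆ =
  (λ _ _ _ → refl , refl) , G⊆ , l , r , (λ i _ → l≤r i) ,
  λ i j _ _ i≢j →
    mk⇔ (proj₂ ∘ to (intervalGraph-edge l r)) (λ o → from (intervalGraph-edge l r) (i≢j , o))

module IntervalModel {n} (S : VSet n) (H : Graph n) (model : IsIntervalOn S H) where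

  left right : Fin n → ℕ
  left  = proj₁ model
  right = proj₁ (proj₂ model)

  left≤right : ∀ i → i ∈ᵥ S → left i ≤ right i
  left≤right = proj₁ (proj₂ (proj₂ model))

  edge⇔ : ∀ {i j} → i ∈ᵥ S → j ∈ᵥ S → Edge H i j ⇔ (i ≢ j × Overlap left right i j)
  edge⇔ {i} {j} i∈S j∈S = mk⇔
    (λ e → edge⇒≢ H e , to (overlap⇔ i j i∈S j∈S (edge⇒≢ H e)) e)
    (λ (i≢j , o) → from (overlap⇔ i j i∈S j∈S i≢j) o)
    where
    overlap⇔ : ∀ i j → i ∈ᵥ S → j ∈ᵥ S → i ≢ j → Edge H i j ⇔ Overlap left right i j
    overlap⇔ = proj₂ (proj₂ (proj₂ model))

induced-isIntervalSupergraph : ∀ {n} (G H : Graph n) (S : VSet n) →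
  IsIntervalSupergraph Full G H → IsIntervalSupergraph S (induced G S) (induced H S)
induced-isIntervalSupergraph G H S (_ , G⊆H , l , r , l≤r , H⇔) =
  (λ i j → induced-edge⁻ H S) ,
  (λ i j e → let (i∈S , j∈S) = induced-edge⁻ G S e in
    from (induced-edge⇔ H S i∈S j∈S) (G⊆H i j (to (induced-edge⇔ G S i∈S j∈S) e))) ,
  l , r , (λ i _ → l≤r i refl) ,
  λ i j i∈S j∈S i≢j → ⇔.trans (induced-edge⇔ H S i∈S j∈S) (H⇔ i j refl refl i≢j)

-- Existence of a minimum interval supergraph

rank : ∀ {m} → (Fin m → ℕ) → ℕ → ℕ
rank {m} e x = ∑[ k < m ] ⟦ does (e k <? x) ⟧

module _ {m} (e : Fin m → ℕ) where

  private
    below-mono : ∀ {a x y} → x ≤ y → ⟦ does (a <? x) ⟧ ≤ ⟦ does (a <? y) ⟧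
    below-mono {a} {x} {y} x≤y =
      ⟦⟧-mono λ a<x → from (does⇔ (a <? y)) (<-≤-trans (to (does⇔ (a <? x)) a<x) x≤y)

  rank-mono : ∀ {x y} → x ≤ y → rank e x ≤ rank e y
  rank-mono x≤y = ∑-mono-≤ {m} λ k → below-mono x≤y

  rank-strict : ∀ {k y} → e k < y → rank e (e k) < rank e y
  rank-strict {k} {y} ek<y = ∑-mono-< (λ _ → below-mono (<⇒≤ ek<y)) k at-k
    where
    at-k : ⟦ does (e k <? e k) ⟧ < ⟦ does (e k <? y) ⟧
    at-k rewrite dec-false (e k <? e k) (<-irrefl refl) | dec-true (e k <? y) ek<y = s≤s z≤n

  rank-bound : ∀ x → rank e x ≤ ∑[ k < m ] 1
  rank-bound x = ∑-mono-≤ {m} λ k → ⟦⟧≤1 _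

-- Each comparison l i ≤ r j survives because r j is itself one of the counted endpoints.
module Compression {n} (l r : Fin n → ℕ) where

  compress : ℕ → ℕ
  compress x = rank l x + rank r x

  compress-mono : ∀ {x y} → x ≤ y → compress x ≤ compress y
  compress-mono x≤y = +-mono-≤ (rank-mono l x≤y) (rank-mono r x≤y)

  compress-reflects : ∀ {x j} → compress x ≤ compress (r j) → x ≤ r j
  compress-reflects {x} {j} cx≤crj with x ≤? r j
  ... | yes x≤rj = x≤rj
  ... | no x≰rj  = contradiction cx≤crj
    (<⇒≱ (+-mono-≤-< (rank-mono l (<⇒≤ (≰⇒> x≰rj))) (rank-strict r (≰⇒> x≰rj))))

  compress-bound : ∀ x → compress x ≤ ∑[ k < n ] 1 + ∑[ k < n ] 1
  compress-bound x = +-mono-≤ (rank-bound l x) (rank-bound r x)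

  overlap-compress : ∀ i j → Overlap l r i j ⇔ Overlap (compress ∘ l) (compress ∘ r) i j
  overlap-compress i j = mk⇔
    (λ (li≤rj , lj≤ri) → compress-mono li≤rj , compress-mono lj≤ri)
    (λ (c₁ , c₂) → compress-reflects c₁ , compress-reflects c₂)

minimise : ∀ {a p} {A : Set a} {P : Pred A p} → Decidable P → (f : A → ℕ) (xs : List A) →
  ∀ {x₀} → P x₀ → Σ A λ x → P x × (∀ {y} → y ∈ xs → P y → f x ≤ f y)
minimise P? f xs {x₀} Px₀ =
  argmin f x₀ (filter P? xs) , argmin-all f Px₀ (all-filter P? xs) ,
  λ y∈xs Py → All.lookup (f[argmin]≤f[xs] x₀ (filter P? xs)) (∈-filter⁺ P? y∈xs Py)

-- After compression, an interval model is a pair of functions Fin n → Fin width, and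
-- these are enumerated by their codes in Fin (width ^ n).
module _ {n} (G : Graph n) where

  private

    width : ℕ
    width = suc (∑[ k < n ] 1 + ∑[ k < n ] 1)

    Code : Set
    Code = Fin (width ^ n) × Fin (width ^ n)

    endpoints : Fin (width ^ n) → Fin n → ℕ
    endpoints c = toℕ ∘ finToFun c

    codeGraph : Code → Graph n
    codeGraph (c , d) = intervalGraph (endpoints c) (endpoints d)

    Admissible : Code → Set
    Admissible (c , d) = (∀ i → endpoints c i ≤ endpoints d i) × G ⊆ᴱ codeGraph (c , d)

    admissible? : Decidable Admissible
    admissible? (c , d) =
      all? (λ i → endpoints c i ≤? endpoints d i) ×-dec
      all? (λ i → all? λ j → (adj G i j ≟ᵇ true) →-dec (adj (codeGraph (c , d)) i j ≟ᵇ true))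

    encode : ∀ H → IsIntervalSupergraph Full G H → Σ Code λ c → Admissible c × SameEdges (codeGraph c) H
    encode H (_ , G⊆H , model) = (funToFin L , funToFin R) , (l≤r , G⊆code) , code≅H
      where
      open IntervalModel Full H model using (left; right; left≤right; edge⇔)
      open Compression left right
      L R : Fin n → Fin width
      L i = fromℕ< (s≤s (compress-bound (left i)))
      R i = fromℕ< (s≤s (compress-bound (right i)))
      decodeL : endpoints (funToFin L) ≗ compress ∘ left
      decodeL i = trans (cong toℕ (finToFun-funToFin L i)) (toℕ-fromℕ< _)
      decodeR : endpoints (funToFin R) ≗ compress ∘ right
      decodeR i = trans (cong toℕ (finToFun-funToFin R i)) (toℕ-fromℕ< _)
      code≅H : SameEdges (codeGraph (funToFin L , funToFin R)) H
      code≅H i j = ⇔.trans (intervalGraph-edge _ _)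
        (⇔.trans (⇔.refl ×-⇔ ⇔.trans (overlap-cong decodeL decodeR i j) (⇔.sym (overlap-compress i j)))
          (⇔.sym (edge⇔ refl refl)))
      l≤r : ∀ i → endpoints (funToFin L) i ≤ endpoints (funToFin R) i
      l≤r i = subst₂ _≤_ (sym (decodeL i)) (sym (decodeR i)) (compress-mono (left≤right i refl))
      G⊆code : G ⊆ᴱ codeGraph (funToFin L , funToFin R)
      G⊆code i j e = from (code≅H i j) (G⊆H i j e)

    allCodes : List Code
    allCodes = cartesianProduct (allFin _) (allFin _)

    complete : Graph n
    complete = intervalGraph (λ _ → 0) (λ _ → 0)

    complete-isIntervalSupergraph : IsIntervalSupergraph Full G complete
    complete-isIntervalSupergraph = intervalGraph-isIntervalSupergraph G (λ _ → 0) (λ _ → 0) (λ _ → z≤n)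
      λ i j e → from (intervalGraph-edge (λ _ → 0) (λ _ → 0)) (edge⇒≢ G e , z≤n , z≤n)

  minimumIntervalSupergraph : Σ (Graph n) (IsMinIntervalSupergraph Full G)
  minimumIntervalSupergraph
    with _ , admissible₀ , _ ← encode complete complete-isIntervalSupergraph
    with (c , d) , (l≤r , G⊆cd) , cd-least ←
           minimise admissible? (edgeCount ∘ codeGraph) allCodes admissible₀ =
    codeGraph (c , d) , intervalGraph-isIntervalSupergraph G _ _ l≤r G⊆cd ,
    λ H H-sup → let (c′ , admissible′ , c′≅H) = encode H H-sup in
      ≤-trans (cd-least (∈-cartesianProduct⁺ (∈-allFin _) (∈-allFin _)) admissible′)
              (≤-reflexive (edgeCount-cong (codeGraph c′) H c′≅H))

-- Replacing the model of a module

-- Helly's theorem on the line: the largest left endpoint is a common point.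
helly : ∀ {a} {A : Set a} (l r : A → ℕ) x₀ xs →
  (∀ {i j} → i ∈ x₀ ∷ xs → j ∈ x₀ ∷ xs → l i ≤ r j) →
  Σ ℕ λ p → ∀ {i} → i ∈ x₀ ∷ xs → l i ≤ p × p ≤ r i
helly {A = A} l r x₀ xs pairwise = l w , λ i∈ → below i∈ , pairwise w∈ i∈
  where
  w : A
  w = argmax l x₀ xs
  w∈ : w ∈ x₀ ∷ xs
  w∈ = argmax-all l {P = _∈ x₀ ∷ xs} (here refl) (All.tabulate there)
  below : ∀ {i} → i ∈ x₀ ∷ xs → l i ≤ l w
  below (here refl)  = f[⊥]≤f[argmax] {f = l} x₀ xs
  below (there i∈xs) = All.lookup (f[xs]≤f[argmax] {f = l} x₀ xs) i∈xs

shift⇔ : ∀ c {a b} → a ≤ b ⇔ c + a ≤ c + b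
shift⇔ c = mk⇔ (+-monoʳ-≤ c) (+-cancelˡ-≤ c _ _)

-- Intervals with endpoints in [0, B] fit into the gaps of the scaled line (suc B) * ℕ.
module Scaling (B : ℕ) where

  unit : ℕ
  unit = suc B

  unscale : ∀ {a b} → unit * a ≤ unit * b + B → a ≤ b
  unscale {a} {b} ua≤ub+B = s≤s⁻¹ (*-cancelˡ-< unit a (suc b) (begin-strict
    unit * a        ≤⟨ ua≤ub+B ⟩
    unit * b + B    <⟨ +-monoʳ-< (unit * b) (n<1+n B) ⟩
    unit * b + unit ≡⟨ +-comm (unit * b) unit ⟩
    unit + unit * b ≡⟨ *-suc unit b ⟨
    unit * suc b    ∎))
    where open Nat.≤-Reasoning

  scale⇔ : ∀ {a b} → a ≤ b ⇔ unit * a ≤ unit * b + B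
  scale⇔ = mk⇔ (λ a≤b → ≤-trans (*-monoʳ-≤ unit a≤b) (m≤m+n _ _)) unscale

  upper⇔ : ∀ {x p b} → x ≤ B → p ≤ b ⇔ unit * p + x ≤ unit * b + B
  upper⇔ {x} {p} x≤B = mk⇔
    (λ p≤b → +-mono-≤ (*-monoʳ-≤ unit p≤b) x≤B)
    (λ up+x≤ub+B → unscale (≤-trans (m≤m+n (unit * p) x) up+x≤ub+B))

  lower⇔ : ∀ {y a p} → y ≤ B → a ≤ p ⇔ unit * a ≤ unit * p + y
  lower⇔ {y} {p = p} y≤B = mk⇔
    (λ a≤p → ≤-trans (*-monoʳ-≤ unit a≤p) (m≤m+n _ _))
    (λ ua≤up+y → unscale (≤-trans ua≤up+y (+-monoʳ-≤ (unit * p) y≤B)))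

module Replacement {n} (G : Graph n) (M : VSet n) (M-module : IsModule G M) {u₀} (u₀∈M : u₀ ∈ᵥ M)
  (GM : Graph n) (GM-min : IsMinIntervalSupergraph M (induced G M) GM)
  (H : Graph n) (H-sup : IsIntervalSupergraph Full G H) where

  open Blocks M using (outDegree; edgeCount-≤-byBlocks)
  open IntervalModel Full H (proj₂ (proj₂ H-sup))
    renaming (left to l; right to r; left≤right to l≤r; edge⇔ to H-edge⇔)
  open IntervalModel M GM (proj₂ (proj₂ (proj₁ GM-min)))
    renaming (left to l′; right to r′; left≤right to l′≤r′; edge⇔ to GM-edge⇔)

  G⊆H : G ⊆ᴱ H
  G⊆H = proj₁ (proj₂ H-sup)

  GM-onM : OnVertexSet M GM
  GM-onM = proj₁ (proj₁ GM-min)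

  G[M]⊆GM : induced G M ⊆ᴱ GM
  G[M]⊆GM = proj₁ (proj₂ (proj₁ GM-min))

  Result : Set
  Result = Σ (Graph n) λ H′ →
    IsIntervalSupergraph Full G H′ × edgeCount H′ ≤ edgeCount H × GM ⊆ᴱ induced H′ M

  -- As M is a module, adjacency to u₀ is adjacency to all of M.
  Neighbour : Fin n → Set
  Neighbour v = v ∉ᵥ M × Edge G v u₀

  neighbour? : Decidable Neighbour
  neighbour? v = (M v ≟ᵇ false) ×-dec (adj G v u₀ ≟ᵇ true)

  neighbour-adj : ∀ {v u} → Neighbour v → u ∈ᵥ M → Edge G v u
  neighbour-adj {v} {u} (v∉M , v~u₀) u∈M with M-module v v∉M
  ... | inj₁ v~M = v~M u u∈M
  ... | inj₂ v≁M = contradiction v~u₀ (v≁M u₀ u₀∈M)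

  adj⇒neighbour : ∀ {v u} → v ∉ᵥ M → u ∈ᵥ M → Edge G v u → Neighbour v
  adj⇒neighbour {v} {u} v∉M u∈M v~u with M-module v v∉M
  ... | inj₁ v~M = v∉M , v~M u₀ u₀∈M
  ... | inj₂ v≁M = contradiction v~u (v≁M u u∈M)

  neighbour-overlap : ∀ {v u} → Neighbour v → u ∈ᵥ M → Overlap l r v u
  neighbour-overlap nv u∈M = proj₂ (to (H-edge⇔ refl refl) (G⊆H _ _ (neighbour-adj nv u∈M)))

  -- Every interval of M reaches over the gap between r w and l v.
  apart⇒GM⊆H[M] : ∀ {v w} → Neighbour v → Neighbour w → r w < l v → GM ⊆ᴱ induced H M
  apart⇒GM⊆H[M] nv nw rw<lv i j e with i∈M , j∈M ← GM-onM i j e =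
    from (induced-edge⇔ H M i∈M j∈M)
      (from (H-edge⇔ refl refl) (edge⇒≢ GM e , across i∈M j∈M , across j∈M i∈M))
    where
    across : ∀ {a b} → a ∈ᵥ M → b ∈ᵥ M → l a ≤ r b
    across a∈M b∈M = ≤-trans (proj₂ (neighbour-overlap nw a∈M))
      (≤-trans (<⇒≤ rw<lv) (proj₁ (neighbour-overlap nv b∈M)))

  commonPoint : (∀ {v w} → Neighbour v → Neighbour w → l v ≤ r w) → ∀ {c} → c ∈ᵥ M →
    Σ ℕ λ p → (l c ≤ p × p ≤ r c) × (∀ {v} → Neighbour v → l v ≤ p × p ≤ r v)
  commonPoint neighbours-meet {c} c∈M =
    let (p , p∈) = helly l r c neighbours pairwise in
    p , p∈ (here refl) , λ nv → p∈ (there (∈-filter⁺ neighbour? (∈-allFin _) nv))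
    where
    neighbours : List (Fin n)
    neighbours = filter neighbour? (allFin n)
    neighbours⁻ : ∀ {v} → v ∈ neighbours → Neighbour v
    neighbours⁻ = proj₂ ∘ ∈-filter⁻ neighbour? {xs = allFin n}
    pairwise : ∀ {i j} → i ∈ c ∷ neighbours → j ∈ c ∷ neighbours → l i ≤ r j
    pairwise (here refl) (here refl) = l≤r c refl
    pairwise (here refl) (there j∈)  = proj₂ (neighbour-overlap (neighbours⁻ j∈) c∈M)
    pairwise (there i∈)  (here refl) = proj₁ (neighbour-overlap (neighbours⁻ i∈) c∈M)
    pairwise (there i∈)  (there j∈)  = neighbours-meet (neighbours⁻ i∈) (neighbours⁻ j∈)

  module Squeezed {centre : Fin n} (centre∈M : centre ∈ᵥ M)
    (centre-fewest : ∀ {u} → u ∈ᵥ M → outDegree H centre ≤ outDegree H u)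
    {point : ℕ} (point∈centre : l centre ≤ point × point ≤ r centre)
    (point∈neighbour : ∀ {v} → Neighbour v → l v ≤ point × point ≤ r v) where

    bound : ℕ
    bound = ∑[ i < n ] r′ i

    open Scaling bound

    l′≤bound : ∀ {i} → i ∈ᵥ M → l′ i ≤ bound
    l′≤bound {i} i∈M = ≤-trans (l′≤r′ i i∈M) (∑-term r′ i)

    L R : Fin n → ℕ
    L i = if M i then unit * point + l′ i else unit * l i
    R i = if M i then unit * point + r′ i else unit * r i + bound

    H′ : Graph n
    H′ = intervalGraph L R

    L≤R : ∀ i → L i ≤ R i
    L≤R i with M i in i∈M
    ... | true  = +-monoʳ-≤ (unit * point) (l′≤r′ i i∈M)
    ... | false = to scale⇔ (l≤r i refl)

    overlap-inside : ∀ {i j} → i ∈ᵥ M → j ∈ᵥ M → Overlap L R i j ⇔ Overlap l′ r′ i j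
    overlap-inside i∈M j∈M rewrite i∈M | j∈M = ⇔.sym (shift⇔ _ ×-⇔ shift⇔ _)

    overlap-outside : ∀ {i j} → i ∉ᵥ M → j ∉ᵥ M → Overlap L R i j ⇔ Overlap l r i j
    overlap-outside i∉M j∉M rewrite i∉M | j∉M = ⇔.sym (scale⇔ ×-⇔ scale⇔)

    overlap-across : ∀ {i j} → i ∈ᵥ M → j ∉ᵥ M → Overlap L R i j ⇔ (l j ≤ point × point ≤ r j)
    overlap-across {i} i∈M j∉M rewrite i∈M | j∉M =
      ⇔.trans (⇔.sym (upper⇔ (l′≤bound i∈M) ×-⇔ lower⇔ (∑-term r′ i))) (mk⇔ swap swap)

    H′-inside : ∀ {i j} → i ∈ᵥ M → j ∈ᵥ M → Edge H′ i j ⇔ Edge GM i j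
    H′-inside i∈M j∈M = ⇔.trans (intervalGraph-edge L R)
      (⇔.trans (⇔.refl ×-⇔ overlap-inside i∈M j∈M) (⇔.sym (GM-edge⇔ i∈M j∈M)))

    H′-outside : ∀ {i j} → i ∉ᵥ M → j ∉ᵥ M → Edge H′ i j ⇔ Edge H i j
    H′-outside i∉M j∉M = ⇔.trans (intervalGraph-edge L R)
      (⇔.trans (⇔.refl ×-⇔ overlap-outside i∉M j∉M) (⇔.sym (H-edge⇔ refl refl)))

    H′-across : ∀ {i j} → i ∈ᵥ M → j ∉ᵥ M → Edge H′ i j ⇔ (l j ≤ point × point ≤ r j)
    H′-across i∈M j∉M = mk⇔
      (λ e → to (overlap-across i∈M j∉M) (proj₂ (to (intervalGraph-edge L R) e)))
      (λ c → from (intervalGraph-edge L R) (∈≢∉ i∈M j∉M , from (overlap-across i∈M j∉M) c))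

    G⊆H′ : G ⊆ᴱ H′
    G⊆H′ i j e with ∈ᵥ-or-∉ᵥ M i | ∈ᵥ-or-∉ᵥ M j
    ... | inj₁ i∈M | inj₁ j∈M =
      from (H′-inside i∈M j∈M) (G[M]⊆GM i j (from (induced-edge⇔ G M i∈M j∈M) e))
    ... | inj₁ i∈M | inj₂ j∉M =
      from (H′-across i∈M j∉M) (point∈neighbour (adj⇒neighbour j∉M i∈M (edge-sym G e)))
    ... | inj₂ i∉M | inj₁ j∈M =
      edge-sym H′ {j} {i} (from (H′-across j∈M i∉M) (point∈neighbour (adj⇒neighbour i∉M j∈M e)))
    ... | inj₂ i∉M | inj₂ j∉M = from (H′-outside i∉M j∉M) (G⊆H i j e)

    GM⊆H′[M] : GM ⊆ᴱ induced H′ M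
    GM⊆H′[M] i j e with i∈M , j∈M ← GM-onM i j e =
      from (induced-edge⇔ H′ M i∈M j∈M) (from (H′-inside i∈M j∈M) e)

    inside≤ : edgeCount (induced H′ M) ≤ edgeCount (induced H M)
    inside≤ = begin
      edgeCount (induced H′ M)
        ≡⟨ edgeCount-cong (induced H′ M) GM (induced-onVertexSet H′ {GM} M GM-onM H′-inside) ⟩
      edgeCount GM
        ≤⟨ proj₂ GM-min (induced H M) (induced-isIntervalSupergraph G H M H-sup) ⟩
      edgeCount (induced H M) ∎
      where open Nat.≤-Reasoning

    -- An outside vertex whose interval contains the point meets the centre's interval.
    outDegree≤ : ∀ {i} → i ∈ᵥ M → outDegree H′ i ≤ outDegree H i
    outDegree≤ {i} i∈M = ≤-trans (∑-mono-≤ {n} via-centre) (centre-fewest i∈M)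
      where
      via-centre : ∀ j → ⟦ not (M j) ∧ adj H′ i j ⟧ ≤ ⟦ not (M j) ∧ adj H centre j ⟧
      via-centre j = ⟦∧⟧-mono (not (M j)) λ ¬j∈M e →
        let j∉M = not-injective ¬j∈M
            (lj≤p , p≤rj) = to (H′-across i∈M j∉M) e in
        from (H-edge⇔ refl refl) (∈≢∉ centre∈M j∉M ,
          ≤-trans (proj₁ point∈centre) p≤rj , ≤-trans lj≤p (proj₂ point∈centre))

    result : Result
    result = H′ , intervalGraph-isIntervalSupergraph G L R L≤R G⊆H′ ,
             edgeCount-≤-byBlocks {H′} {H} inside≤ outDegree≤ H′-outside , GM⊆H′[M]

  replacement : Result
  replacement with any? (λ v → any? λ w → neighbour? v ×-dec neighbour? w ×-dec r w <? l v)
  ... | yes (v , w , nv , nw , rw<lv) = H , H-sup , ≤-refl , apart⇒GM⊆H[M] nv nw rw<lv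
  ... | no ¬apart
    with centre , centre∈M , centre-fewest ← minimise (λ u → M u ≟ᵇ true) (outDegree H) (allFin n) u₀∈M
    with point , point∈centre , point∈neighbour ←
           commonPoint (λ {v} {w} nv nw → ≮⇒≥ λ rw<lv → ¬apart (v , w , nv , nw , rw<lv)) centre∈M =
    Squeezed.result centre∈M (centre-fewest (∈-allFin _)) point∈centre point∈neighbour

corollary3 : ∀ {n} (G : Graph n) (M : VSet n) → IsConnectedModule G M →
    (GM : Graph n) → IsMinIntervalSupergraph M (induced G M) GM →
    Σ (Graph n) λ Ĝ → IsMinIntervalSupergraph Full G Ĝ ×
      (∀ i j → Edge GM i j → Edge (induced Ĝ M) i j)
corollary3 G M (M-module , (u₀ , u₀∈M) , _) GM GM-min
  with H , H-sup , H-min ← minimumIntervalSupergraph G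
  with Ĝ , Ĝ-sup , Ĝ≤H , GM⊆Ĝ[M] ← Replacement.replacement G M M-module u₀∈M GM GM-min H H-sup =
  Ĝ , (Ĝ-sup , λ K K-sup → ≤-trans Ĝ≤H (H-min K K-sup)) , GM⊆Ĝ[M]
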